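{- Every factor $u$ of the Zimin word $Z$ can be written uniquely in the form $u=u_A\,x_{k(u)}\,v_B$ with $A,B\subset[1,k(u)[$.
   Context: Alphabet $\{x_1,x_2,\ldots\}$. $Z_1=x_1$, $Z_{m+1}=Z_mx_{m+1}Z_m$, and the Zimin word $Z=\lim Z_m=x_1x_2x_1x_3x_1x_2x_1x_4\ldots$. A factor of $Z$ is a nonempty finite word occurring in $Z$; $k(u)=\max\{k: x_k \text{ occurs in } u\}$. $u_1=v_1=x_1$, $u_{m+1}=x_{m+1}u_1\cdots u_m$, $v_{m+1}=v_m v_{m-1}\cdots v_1x_{m+1}$. $[a,b[=\{a,\ldots,b-1\}$. For finite $A=\{i_1<\cdots<i_k\}$, $u_A=u_{i_1}\cdots u_{i_k}$; for $B=\{j_1<\cdots<j_k\}$, $v_B=v_{j_k}\cdots v_{j_1}$; empty products are the empty word. -}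

module Defs where

open import Data.Nat using (ℕ; zero; suc; _⊔_; _<_; _≤_)
open import Data.List using (List; []; _∷_; _++_; [_]; map; concat; reverse; foldr)
open import Data.List.Relation.Unary.All using (All)
open import Data.List.Relation.Unary.Linked using (Linked)
open import Data.Product using (Σ; ∃; _×_)
open import Relation.Binary.PropositionalEquality using (_≡_)
open import Relation.Nullary using (¬_)

-- The letter x_i is encoded by the natural number i (i ≥ 1).
Word : Set
Word = List ℕ

-- Zimin m = Z_m for m ≥ 1 (Zimin 0 = empty word, so Z_1 = x_1 and Z_{m+1} = Z_m x_{m+1} Z_m).
Zimin : ℕ → Word
Zimin zero    = []
Zimin (suc m) = Zimin m ++ (suc m ∷ Zimin m)

-- u is a factor of the infinite Zimin word Z: nonempty and occurs in some Z_m
-- (every finite prefix of Z is a prefix of some Z_m, and each Z_m is a prefix of Z).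
Factor : Word → Set
Factor u = ¬ (u ≡ []) × ∃ λ m → ∃ λ p → ∃ λ s → Zimin m ≡ p ++ u ++ s

kOf : Word → ℕ
kOf = foldr _⊔_ 0

-- uAt i = u_i for i ≥ 1, and Us m = u_1 u_2 ⋯ u_m, so u_{m+1} = x_{m+1} u_1 ⋯ u_m.
mutual
  uAt : ℕ → Word
  uAt zero    = []
  uAt (suc m) = suc m ∷ Us m

  Us : ℕ → Word
  Us zero    = []
  Us (suc m) = Us m ++ uAt (suc m)

-- vAt i = v_i for i ≥ 1, and Vs m = v_m v_{m-1} ⋯ v_1, so v_{m+1} = v_m ⋯ v_1 x_{m+1}.
mutual
  vAt : ℕ → Word
  vAt zero    = []
  vAt (suc m) = Vs m ++ [ suc m ]

  Vs : ℕ → Word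
  Vs zero    = []
  Vs (suc m) = vAt (suc m) ++ Vs m

-- A finite set of indices is represented by its strictly increasing list of elements.
-- SubsetOf k A : A is a finite subset of [1, k[ = {1, …, k-1}.
SubsetOf : ℕ → List ℕ → Set
SubsetOf k A = Linked _<_ A × All (λ i → 1 ≤ i × i < k) A

uSet : List ℕ → Word
uSet A = concat (map uAt A)

vSet : List ℕ → Word
vSet B = concat (map vAt (reverse B))

-- Since Z_{n+1} = Z_n x_{n+1} Z_n and Z_n = u_1 ⋯ u_n with u_{i+1} = x_{i+1} Z_i, every suffix
-- of Z_n is some u_A with A ⊆ [1, n]. Z_n is a palindrome and v_B is the mirror image of u_B,
-- so every prefix of Z_n is some v_B. A factor of Z_{n+1} lies inside one copy of Z_n or
-- straddles the middle letter, in which case it is (suffix of Z_n) x_{n+1} (prefix of Z_n).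
-- For uniqueness, all letters of u_A and v_B are below k, so x_k occurs exactly once, and
-- u_A determines A because each u_i begins with the letter x_i.
module Submission where

open import Defs
open import Level using (Level)
open import Function using (_∘′_)
open import Data.Empty using (⊥-elim)
open import Data.List using (List; []; _∷_; _++_; [_]; _∷ʳ_; map; concat; reverse)
open import Data.List.Properties
  using (∷-injective; ∷-injectiveʳ; ++-assoc; ++-identityʳ; ++-cancelˡ; ++-conicalˡ; ++-conicalʳ;
         map-++; concat-++; reverse-++; unfold-reverse; reverse-involutive)
open import Data.List.Relation.Unary.All as All using (All; []; _∷_)
open import Data.List.Relation.Unary.All.Properties using (++⁺; ∷ʳ⁺)
open import Data.List.Relation.Unary.Linked using (Linked; []; [-]; _∷_)
open import Data.Nat using (ℕ; zero; suc; _⊔_; _≤_; _<_; z≤n; s≤s)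
open import Data.Nat.Properties
  using (≤-refl; ≤-<-trans; m≤n⇒m≤1+n; <⇒≤; <⇒≢; m≤n⇒m⊔n≡n; m≥n⇒m⊔n≡m; ⊔-lub)
open import Data.Product using (Σ; ∃; ∃₂; _×_; _,_; proj₁; proj₂; map₂)
open import Data.Sum using (_⊎_; inj₁; inj₂)
open import Relation.Nullary using (¬_)
open import Relation.Binary using (Rel)
open import Relation.Binary.PropositionalEquality
  using (_≡_; _≢_; refl; sym; trans; cong; cong₂; subst; module ≡-Reasoning)

open ≡-Reasoning

private
  variable
    a : Level
    X : Set a

_IsPrefixOf_ _IsSuffixOf_ _IsInfixOf_ : List X → List X → Set _
p IsPrefixOf w = ∃ λ s → w ≡ p ++ s
s IsSuffixOf w = ∃ λ t → w ≡ t ++ s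
u IsInfixOf w = ∃₂ λ p s → w ≡ p ++ u ++ s

reverse-IsPrefixOf : ∀ {p w : List X} → p IsPrefixOf w → reverse p IsSuffixOf reverse w
reverse-IsPrefixOf {p = p} (s , refl) = reverse s , reverse-++ p s

prefix-++-∷ : ∀ (xs : List X) {c ys p} → p IsPrefixOf (xs ++ c ∷ ys) →
  p IsPrefixOf xs ⊎ ∃ λ r → r IsPrefixOf ys × p ≡ xs ++ c ∷ r
prefix-++-∷ []        {p = []}     _       = inj₁ ([] , refl)
prefix-++-∷ []        {p = x ∷ p}  (s , e) with ∷-injective e
... | refl , e′ = inj₂ (p , (s , e′) , refl)
prefix-++-∷ (x ∷ xs)  {p = []}     _       = inj₁ (x ∷ xs , refl)
prefix-++-∷ (x ∷ xs)  {p = y ∷ p}  (s , e) with ∷-injective e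
... | refl , e′ with prefix-++-∷ xs (s , e′)
...   | inj₁ (s′ , xs≡) = inj₁ (s′ , cong (x ∷_) xs≡)
...   | inj₂ (r , r≼ys , p≡) = inj₂ (r , r≼ys , cong (x ∷_) p≡)

suffix-++-∷ : ∀ (xs : List X) {c ys s} → s IsSuffixOf (xs ++ c ∷ ys) →
  s IsSuffixOf ys ⊎ ∃ λ r → r IsSuffixOf xs × s ≡ r ++ c ∷ ys
suffix-++-∷ xs       ([]    , e) = inj₂ (xs , ([] , refl) , sym e)
suffix-++-∷ []       (y ∷ t , e) = inj₁ (t , ∷-injectiveʳ e)
suffix-++-∷ (x ∷ xs) (y ∷ t , e) with ∷-injective e
... | refl , e′ with suffix-++-∷ xs (t , e′)
...   | inj₁ s≽ys = inj₁ s≽ys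
...   | inj₂ (r , (t′ , xs≡) , s≡) = inj₂ (r , (x ∷ t′ , cong (x ∷_) xs≡) , s≡)

infix-++-∷ : ∀ (xs : List X) {c ys u} → u IsInfixOf (xs ++ c ∷ ys) →
  u IsInfixOf xs ⊎ u IsInfixOf ys ⊎
  ∃₂ λ l r → l IsSuffixOf xs × r IsPrefixOf ys × u ≡ l ++ c ∷ r
infix-++-∷ xs (p , s , e) with suffix-++-∷ xs (p , e)
... | inj₁ (t , ys≡) = inj₂ (inj₁ (t , s , ys≡))
... | inj₂ (l , (t , xs≡) , us≡) with prefix-++-∷ l (s , sym us≡)
...   | inj₁ (s′ , l≡) = inj₁ (t , s′ , trans xs≡ (cong (t ++_) l≡))
...   | inj₂ (r , r≼ys , u≡) = inj₂ (inj₂ (l , r , (t , xs≡) , r≼ys , u≡))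

++-∷-cancel : ∀ {c : X} {xs xs′ ys ys′} → All (_≢ c) xs → All (_≢ c) xs′ →
  xs ++ c ∷ ys ≡ xs′ ++ c ∷ ys′ → xs ≡ xs′ × ys ≡ ys′
++-∷-cancel []           []             e = refl , ∷-injectiveʳ e
++-∷-cancel []           (x′≢c ∷ _)     e = ⊥-elim (x′≢c (sym (proj₁ (∷-injective e))))
++-∷-cancel (x≢c ∷ _)    []             e = ⊥-elim (x≢c (proj₁ (∷-injective e)))
++-∷-cancel (_ ∷ xs≢c)   (_ ∷ xs′≢c)    e with ∷-injective e
... | refl , e′ with ++-∷-cancel xs≢c xs′≢c e′
...   | xs≡ , ys≡ = cong (_ ∷_) xs≡ , ys≡

Linked-∷ʳ : ∀ {ℓ} {R : Rel X ℓ} {x xs} → Linked R xs → All (λ y → R y x) xs → Linked R (xs ∷ʳ x)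
Linked-∷ʳ []          []             = [-]
Linked-∷ʳ [-]         (Ryx ∷ [])     = Ryx ∷ [-]
Linked-∷ʳ (Ryz ∷ Rzs) (_ ∷ Rzx ∷ Rxs) = Ryz ∷ Linked-∷ʳ Rzs (Rzx ∷ Rxs)

kOf-≤ : ∀ {k xs} → All (_≤ k) xs → kOf xs ≤ k
kOf-≤ []           = z≤n
kOf-≤ (x≤k ∷ xs≤k) = ⊔-lub x≤k (kOf-≤ xs≤k)

kOf-++-∷ : ∀ {k xs ys} → All (_< k) xs → All (_≤ k) ys → kOf (xs ++ k ∷ ys) ≡ k
kOf-++-∷ []           ys≤k = m≥n⇒m⊔n≡m (kOf-≤ ys≤k)
kOf-++-∷ (x<k ∷ xs<k) ys≤k = trans (cong (_ ⊔_) (kOf-++-∷ xs<k ys≤k)) (m≤n⇒m⊔n≡n (<⇒≤ x<k))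

Us≡Zimin : ∀ m → Us m ≡ Zimin m
Us≡Zimin zero    = refl
Us≡Zimin (suc m) = cong (λ w → w ++ suc m ∷ w) (Us≡Zimin m)

Vs≡Zimin : ∀ m → Vs m ≡ Zimin m
Vs≡Zimin zero    = refl
Vs≡Zimin (suc m) = begin
  (Vs m ++ [ suc m ]) ++ Vs m  ≡⟨ ++-assoc (Vs m) [ suc m ] (Vs m) ⟩
  Vs m ++ suc m ∷ Vs m         ≡⟨ cong (λ w → w ++ suc m ∷ w) (Vs≡Zimin m) ⟩
  Zimin (suc m)                ∎

uAt-suc : ∀ m → uAt (suc m) ≡ suc m ∷ Zimin m
uAt-suc m = cong (suc m ∷_) (Us≡Zimin m)

reverse-Zimin : ∀ m → reverse (Zimin m) ≡ Zimin m
reverse-Zimin zero    = refl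
reverse-Zimin (suc m) = begin
  reverse (Z ++ suc m ∷ Z)             ≡⟨ reverse-++ Z (suc m ∷ Z) ⟩
  reverse (suc m ∷ Z) ++ reverse Z     ≡⟨ cong (_++ reverse Z) (unfold-reverse (suc m) Z) ⟩
  (reverse Z ∷ʳ suc m) ++ reverse Z    ≡⟨ ++-assoc (reverse Z) [ suc m ] (reverse Z) ⟩
  reverse Z ++ suc m ∷ reverse Z       ≡⟨ cong (λ w → w ++ suc m ∷ w) (reverse-Zimin m) ⟩
  Z ++ suc m ∷ Z                       ∎
  where Z = Zimin m

reverse-vAt : ∀ i → reverse (vAt i) ≡ uAt i
reverse-vAt zero    = refl
reverse-vAt (suc m) = begin
  reverse (Vs m ++ [ suc m ])  ≡⟨ reverse-++ (Vs m) [ suc m ] ⟩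
  suc m ∷ reverse (Vs m)       ≡⟨ cong (λ w → suc m ∷ reverse w) (Vs≡Zimin m) ⟩
  suc m ∷ reverse (Zimin m)    ≡⟨ cong (suc m ∷_) (reverse-Zimin m) ⟩
  suc m ∷ Zimin m              ≡⟨ uAt-suc m ⟨
  uAt (suc m)                  ∎

uSet-∷ʳ : ∀ A i → uSet (A ∷ʳ i) ≡ uSet A ++ uAt i
uSet-∷ʳ A i = begin
  concat (map uAt (A ++ [ i ]))       ≡⟨ cong concat (map-++ uAt A [ i ]) ⟩
  concat (map uAt A ++ [ uAt i ])     ≡⟨ concat-++ (map uAt A) [ uAt i ] ⟨
  uSet A ++ uAt i ++ []               ≡⟨ cong (uSet A ++_) (++-identityʳ (uAt i)) ⟩
  uSet A ++ uAt i                     ∎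

vSet-∷ : ∀ b B → vSet (b ∷ B) ≡ vSet B ++ vAt b
vSet-∷ b B = begin
  concat (map vAt (reverse (b ∷ B)))         ≡⟨ cong (concat ∘′ map vAt) (unfold-reverse b B) ⟩
  concat (map vAt (reverse B ∷ʳ b))          ≡⟨ cong concat (map-++ vAt (reverse B) [ b ]) ⟩
  concat (map vAt (reverse B) ++ [ vAt b ])  ≡⟨ concat-++ (map vAt (reverse B)) [ vAt b ] ⟨
  vSet B ++ vAt b ++ []                      ≡⟨ cong (vSet B ++_) (++-identityʳ (vAt b)) ⟩
  vSet B ++ vAt b                            ∎

reverse-vSet : ∀ B → reverse (vSet B) ≡ uSet B
reverse-vSet []      = refl
reverse-vSet (b ∷ B) = begin
  reverse (vSet (b ∷ B))               ≡⟨ cong reverse (vSet-∷ b B) ⟩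
  reverse (vSet B ++ vAt b)            ≡⟨ reverse-++ (vSet B) (vAt b) ⟩
  reverse (vAt b) ++ reverse (vSet B)  ≡⟨ cong₂ _++_ (reverse-vAt b) (reverse-vSet B) ⟩
  uSet (b ∷ B)                         ∎

vSet≡reverse-uSet : ∀ B → vSet B ≡ reverse (uSet B)
vSet≡reverse-uSet B = trans (sym (reverse-involutive (vSet B))) (cong reverse (reverse-vSet B))

SubsetOf⇒positive : ∀ {k A} → SubsetOf k A → All (1 ≤_) A
SubsetOf⇒positive (_ , A∈) = All.map proj₁ A∈

SubsetOf⇒< : ∀ {k A} → SubsetOf k A → All (_< k) A
SubsetOf⇒< (_ , A∈) = All.map proj₂ A∈

SubsetOf-weaken : ∀ {k A} → SubsetOf k A → SubsetOf (suc k) A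
SubsetOf-weaken (A< , A∈) = A< , All.map (map₂ m≤n⇒m≤1+n) A∈

SubsetOf-∷ʳ : ∀ {n A} → SubsetOf (suc n) A → SubsetOf (suc (suc n)) (A ∷ʳ suc n)
SubsetOf-∷ʳ sA@(A< , A∈) =
  Linked-∷ʳ A< (SubsetOf⇒< sA) , ∷ʳ⁺ (All.map (map₂ m≤n⇒m≤1+n) A∈) (s≤s z≤n , ≤-refl)

Zimin-≤ : ∀ m → All (_≤ m) (Zimin m)
Zimin-≤ zero    = []
Zimin-≤ (suc m) = ++⁺ below (≤-refl ∷ below)
  where below = All.map m≤n⇒m≤1+n (Zimin-≤ m)

uAt-≤ : ∀ i → All (_≤ i) (uAt i)
uAt-≤ zero    = []
uAt-≤ (suc m) = subst (All (_≤ suc m)) (sym (uAt-suc m)) (≤-refl ∷ All.map m≤n⇒m≤1+n (Zimin-≤ m))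

vAt-≤ : ∀ i → All (_≤ i) (vAt i)
vAt-≤ zero    = []
vAt-≤ (suc m) = subst (λ w → All (_≤ suc m) (w ++ [ suc m ])) (sym (Vs≡Zimin m))
  (∷ʳ⁺ (All.map m≤n⇒m≤1+n (Zimin-≤ m)) ≤-refl)

uSet-< : ∀ {k A} → All (_< k) A → All (_< k) (uSet A)
uSet-< []          = []
uSet-< (i<k ∷ A<k) = ++⁺ (All.map (λ j≤i → ≤-<-trans j≤i i<k) (uAt-≤ _)) (uSet-< A<k)

vSet-< : ∀ {k B} → All (_< k) B → All (_< k) (vSet B)
vSet-< []                      = []
vSet-< {k} {b ∷ B} (b<k ∷ B<k) = subst (All (_< k)) (sym (vSet-∷ b B))
  (++⁺ (vSet-< B<k) (All.map (λ j≤b → ≤-<-trans j≤b b<k) (vAt-≤ b)))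

uSet-injective : ∀ {A A′} → All (1 ≤_) A → All (1 ≤_) A′ → uSet A ≡ uSet A′ → A ≡ A′
uSet-injective []            []              _  = refl
uSet-injective []            (s≤s z≤n ∷ _)   ()
uSet-injective (s≤s z≤n ∷ _) []              ()
uSet-injective {suc i ∷ _} (s≤s z≤n ∷ A≥1) (s≤s z≤n ∷ A′≥1) e with ∷-injective e
... | refl , e′ = cong (suc i ∷_) (uSet-injective A≥1 A′≥1 (++-cancelˡ (Us i) _ _ e′))

vSet-injective : ∀ {B B′} → All (1 ≤_) B → All (1 ≤_) B′ → vSet B ≡ vSet B′ → B ≡ B′
vSet-injective {B} {B′} B≥1 B′≥1 e = uSet-injective B≥1 B′≥1 (begin
  uSet B              ≡⟨ reverse-vSet B ⟨
  reverse (vSet B)    ≡⟨ cong reverse e ⟩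
  reverse (vSet B′)   ≡⟨ reverse-vSet B′ ⟩
  uSet B′             ∎)

suffix-Zimin : ∀ n {s} → s IsSuffixOf Zimin n → ∃ λ A → SubsetOf (suc n) A × s ≡ uSet A
suffix-Zimin zero    {s} (t , e) = [] , ([] , []) , ++-conicalʳ t s (sym e)
suffix-Zimin (suc n) {s} s≽Z with suffix-++-∷ (Zimin n) s≽Z
... | inj₁ s≽Zₙ with suffix-Zimin n s≽Zₙ
...   | A , sA , s≡ = A , SubsetOf-weaken sA , s≡
suffix-Zimin (suc n) {s} s≽Z | inj₂ (r , r≽Zₙ , s≡) with suffix-Zimin n r≽Zₙ
...   | A , sA , r≡ = A ∷ʳ suc n , SubsetOf-∷ʳ sA , (begin
  s                      ≡⟨ s≡ ⟩
  r ++ suc n ∷ Zimin n   ≡⟨ cong₂ _++_ r≡ (sym (uAt-suc n)) ⟩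
  uSet A ++ uAt (suc n)  ≡⟨ uSet-∷ʳ A (suc n) ⟨
  uSet (A ∷ʳ suc n)      ∎)

prefix-Zimin : ∀ n {p} → p IsPrefixOf Zimin n → ∃ λ B → SubsetOf (suc n) B × p ≡ vSet B
prefix-Zimin n {p} p≼Z
  with suffix-Zimin n (subst (reverse p IsSuffixOf_) (reverse-Zimin n) (reverse-IsPrefixOf p≼Z))
... | B , sB , rp≡ = B , sB , (begin
  p                    ≡⟨ reverse-involutive p ⟨
  reverse (reverse p)  ≡⟨ cong reverse rp≡ ⟩
  reverse (uSet B)     ≡⟨ vSet≡reverse-uSet B ⟨
  vSet B               ∎)

Decomposition : ℕ → Word → Set
Decomposition k u = ∃₂ λ A B → SubsetOf k A × SubsetOf k B × u ≡ uSet A ++ k ∷ vSet B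

infix-Zimin-decomposition : ∀ m {u} → ¬ u ≡ [] → u IsInfixOf Zimin m → ∃ λ k → Decomposition k u
infix-Zimin-decomposition zero    {u} u≢[] (p , s , e) =
  ⊥-elim (u≢[] (++-conicalˡ u s (++-conicalʳ p (u ++ s) (sym e))))
infix-Zimin-decomposition (suc n) u≢[] u≼Z with infix-++-∷ (Zimin n) u≼Z
... | inj₁ u≼Zₙ        = infix-Zimin-decomposition n u≢[] u≼Zₙ
... | inj₂ (inj₁ u≼Zₙ) = infix-Zimin-decomposition n u≢[] u≼Zₙ
... | inj₂ (inj₂ (l , r , l≽Zₙ , r≼Zₙ , u≡)) with suffix-Zimin n l≽Zₙ | prefix-Zimin n r≼Zₙ
...   | A , sA , l≡ | B , sB , r≡ =
  suc n , A , B , sA , sB , trans u≡ (cong₂ (λ x y → x ++ suc n ∷ y) l≡ r≡)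

kOf-decomposition : ∀ {k A B} → SubsetOf k A → SubsetOf k B → kOf (uSet A ++ k ∷ vSet B) ≡ k
kOf-decomposition sA sB =
  kOf-++-∷ (uSet-< (SubsetOf⇒< sA)) (All.map <⇒≤ (vSet-< (SubsetOf⇒< sB)))

decomposition-unique : ∀ {k A B A′ B′} →
  SubsetOf k A → SubsetOf k B → SubsetOf k A′ → SubsetOf k B′ →
  uSet A ++ k ∷ vSet B ≡ uSet A′ ++ k ∷ vSet B′ → A ≡ A′ × B ≡ B′
decomposition-unique sA sB sA′ sB′ e
  with ++-∷-cancel (All.map <⇒≢ (uSet-< (SubsetOf⇒< sA))) (All.map <⇒≢ (uSet-< (SubsetOf⇒< sA′))) e
... | uA≡ , vB≡ =
  uSet-injective (SubsetOf⇒positive sA) (SubsetOf⇒positive sA′) uA≡ ,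
  vSet-injective (SubsetOf⇒positive sB) (SubsetOf⇒positive sB′) vB≡

proposition8 : (u : Word) → Factor u →
    Σ (List ℕ) λ A → Σ (List ℕ) λ B →
      (SubsetOf (kOf u) A × SubsetOf (kOf u) B × u ≡ uSet A ++ (kOf u ∷ vSet B))
      × ((A′ B′ : List ℕ) → SubsetOf (kOf u) A′ → SubsetOf (kOf u) B′ →
           u ≡ uSet A′ ++ (kOf u ∷ vSet B′) → A′ ≡ A × B′ ≡ B)
proposition8 u (u≢[] , m , u≼Zₘ) with infix-Zimin-decomposition m u≢[] u≼Zₘ
... | k , A , B , sA , sB , refl rewrite kOf-decomposition sA sB =
  A , B , (sA , sB , refl) , λ A′ B′ sA′ sB′ e → decomposition-unique sA′ sB′ sA sB (sym e)
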